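{- Let $N$ be an odd perfect number (i.e. $\sigma(N)=2N$). Suppose that $3\mid N$, $5\mid N$ and $13\mid N$. Then either $5\,\|\,N$ or $3^2\,\|\,N$.
   Context: $\sigma(N)$ is the sum of the positive divisors of $N$. For a prime power $p^a$, $p^a\,\|\,N$ means $p^a\mid N$ but $p^{a+1}\nmid N$. -}

module Defs where

open import Data.Nat using (ℕ; zero; suc; _+_; _*_; _^_)
open import Data.Nat.Divisibility using (_∣_; _∣?_)
open import Data.List using (List; filter)
open import Data.Nat.ListAction using (sum)
open import Data.List using (upTo)
open import Data.List using (map)
open import Data.Product using (_×_)
open import Relation.Nullary using (¬_)

σ : ℕ → ℕ
σ n = sum (filter (_∣? n) (map suc (upTo n)))

ExactPow : ℕ → ℕ → ℕ → Set
ExactPow p a n = (p ^ a) ∣ n × ¬ ((p ^ suc a) ∣ n)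

{-# OPTIONS --safe #-}
-- Suppose 5² ∣ N and 3^a ∥ N with a ≠ 2. Because σ is multiplicative on the coprime factors
-- 3^a and N/3^a, σ(3^a) divides σ(N) = 2N; as N is odd, 4 ∤ σ(3^a), which rules out a = 1, 3, 5
-- (σ = 4, 40, 364). Every divisor d of a perfect number satisfies σ(d)/d ≤ σ(N)/N = 2; this fails
-- for d = 3⁶·5²·13 when a ≥ 6, and for d = 3⁴·5²·11·13 when a = 4, since then 11² = σ(3⁴)
-- divides 2N.
module Submission where

open import Defs
open import Data.Bool using (true; false; if_then_else_)
open import Data.Empty using (⊥-elim)
open import Data.List using ([_]; _++_; filter; map; upTo)
open import Data.List.Properties using (filter-++; map-++; upTo-∷ʳ)
open import Data.Nat using (ℕ; zero; suc; _+_; _*_; _∸_; _^_; _≤_; _<_; z≤n; s≤s; NonZero; >-nonZero)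
open import Data.Nat.Properties
open import Data.Nat.Coprimality using (Coprime; coprime?; coprime-divisor; coprime⇒gcd≡1)
open import Data.Nat.Divisibility
open import Data.Nat.LCM using (lcm; lcm-least; gcd*lcm)
open import Data.Nat.ListAction using (sum)
open import Data.Nat.ListAction.Properties using (sum-++)
open import Data.Nat.Primality using (Prime; prime?; ¬prime[0]; ¬prime[1]; prime⇒irreducible; prime⇒nonZero)
open import Data.Product using (_,_)
open import Data.Sum using (_⊎_; inj₁; inj₂)
open import Relation.Binary.PropositionalEquality using (_≡_; refl; sym; trans; cong; cong₂; subst; subst₂; module ≡-Reasoning)
open import Relation.Nullary using (¬_; Dec; yes; no; does; contradiction)
open import Relation.Nullary.Decidable using (from-yes; from-no)
open import Relation.Unary using (Decidable)
open import Algebra.Properties.CommutativeSemigroup +-commutativeSemigroup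
  using () renaming (interchange to +-interchange)
open import Algebra.Properties.CommutativeSemigroup *-commutativeSemigroup
  using () renaming (x∙yz≈y∙xz to *-left-comm)

sumTo : (ℕ → ℕ) → ℕ → ℕ
sumTo f zero    = 0
sumTo f (suc n) = sumTo f n + f (suc n)

sumTo-cong : ∀ {f g} n → (∀ {i} → 1 ≤ i → i ≤ n → f i ≡ g i) → sumTo f n ≡ sumTo g n
sumTo-cong zero    f≡g = refl
sumTo-cong (suc n) f≡g =
  cong₂ _+_ (sumTo-cong n (λ 1≤i i≤n → f≡g 1≤i (m≤n⇒m≤1+n i≤n))) (f≡g (s≤s z≤n) ≤-refl)

sumTo-zero : ∀ {f} n → (∀ {i} → 1 ≤ i → i ≤ n → f i ≡ 0) → sumTo f n ≡ 0
sumTo-zero zero    f≡0 = refl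
sumTo-zero (suc n) f≡0 =
  cong₂ _+_ (sumTo-zero n (λ 1≤i i≤n → f≡0 1≤i (m≤n⇒m≤1+n i≤n))) (f≡0 (s≤s z≤n) ≤-refl)

sumTo-+ : ∀ f g n → sumTo (λ i → f i + g i) n ≡ sumTo f n + sumTo g n
sumTo-+ f g zero    = refl
sumTo-+ f g (suc n) = begin
  sumTo (λ i → f i + g i) n + (f (suc n) + g (suc n))
    ≡⟨ cong (_+ (f (suc n) + g (suc n))) (sumTo-+ f g n) ⟩
  sumTo f n + sumTo g n + (f (suc n) + g (suc n))
    ≡⟨ +-interchange (sumTo f n) (sumTo g n) (f (suc n)) (g (suc n)) ⟩
  sumTo f (suc n) + sumTo g (suc n) ∎
  where open ≡-Reasoning

sumTo-*ˡ : ∀ c f n → sumTo (λ i → c * f i) n ≡ c * sumTo f n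
sumTo-*ˡ c f zero    = sym (*-zeroʳ c)
sumTo-*ˡ c f (suc n) =
  trans (cong (_+ c * f (suc n)) (sumTo-*ˡ c f n)) (sym (*-distribˡ-+ c (sumTo f n) (f (suc n))))

sumTo-split : ∀ f m n → sumTo f (m + n) ≡ sumTo f m + sumTo (λ i → f (m + i)) n
sumTo-split f m zero    = trans (cong (sumTo f) (+-identityʳ m)) (sym (+-identityʳ _))
sumTo-split f m (suc n) = begin
  sumTo f (m + suc n)                         ≡⟨ cong (sumTo f) (+-suc m n) ⟩
  sumTo f (m + n) + f (suc (m + n))           ≡⟨ cong (_+ f (suc (m + n))) (sumTo-split f m n) ⟩
  sumTo f m + sumTo g n + f (suc (m + n))     ≡⟨ +-assoc (sumTo f m) (sumTo g n) (f (suc (m + n))) ⟩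
  sumTo f m + (sumTo g n + f (suc (m + n)))   ≡⟨ cong (λ k → sumTo f m + (sumTo g n + f k)) (+-suc m n) ⟨
  sumTo f m + sumTo g (suc n)                 ∎
  where
  open ≡-Reasoning
  g : ℕ → ℕ
  g i = f (m + i)

-- Each block p·K+1, …, p·K+p contributes only its last term p·(K+1).
sumTo-multiples : ∀ q {f} → (∀ {i} → suc q ∤ i → f i ≡ 0) →
                  ∀ K → sumTo f (suc q * K) ≡ sumTo (λ e → f (suc q * e)) K
sumTo-multiples q {f} f≡0 zero    = cong (sumTo f) (*-zeroʳ q)
sumTo-multiples q {f} f≡0 (suc K) = begin
  sumTo f (p * suc K)                              ≡⟨ cong (sumTo f) p*[1+K]≡p*K+p ⟩
  sumTo f (p * K + p)                              ≡⟨ sumTo-split f (p * K) p ⟩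
  sumTo f (p * K) + sumTo (λ i → f (p * K + i)) p  ≡⟨ cong₂ _+_ (sumTo-multiples q f≡0 K) lastBlock ⟩
  sumTo (λ e → f (p * e)) K + f (p * suc K)        ∎
  where
  open ≡-Reasoning
  p : ℕ
  p = suc q
  p*[1+K]≡p*K+p : p * suc K ≡ p * K + p
  p*[1+K]≡p*K+p = trans (*-suc p K) (+-comm p (p * K))
  p∤p*K+i : ∀ {i} → 1 ≤ i → i ≤ q → p ∤ p * K + i
  p∤p*K+i 1≤i i≤q p∣ = <⇒≱ (s≤s i≤q) (∣⇒≤ {{>-nonZero 1≤i}} (∣m+n∣m⇒∣n p∣ (m∣m*n K)))
  lastBlock : sumTo (λ i → f (p * K + i)) p ≡ f (p * suc K)
  lastBlock = cong₂ _+_ (sumTo-zero q (λ 1≤i i≤q → f≡0 (p∤p*K+i 1≤i i≤q))) (cong f (sym p*[1+K]≡p*K+p))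

if-does-yes : ∀ {P : Set} (P? : Dec P) {x y : ℕ} → P → (if does P? then x else y) ≡ x
if-does-yes (yes _) _  = refl
if-does-yes (no ¬p) p = contradiction p ¬p

if-does-no : ∀ {P : Set} (P? : Dec P) {x y : ℕ} → ¬ P → (if does P? then x else y) ≡ y
if-does-no (yes p) ¬p = contradiction p ¬p
if-does-no (no _)  _  = refl

divisorTerm : ℕ → ℕ → ℕ
divisorTerm n d = if does (d ∣? n) then d else 0

divisorTerm-∤ : ∀ {n d} → d ∤ n → divisorTerm n d ≡ 0
divisorTerm-∤ {n} {d} = if-does-no (d ∣? n)

divisorTerm-cong : ∀ {m n d} → (d ∣ m → d ∣ n) → (d ∣ n → d ∣ m) → divisorTerm m d ≡ divisorTerm n d
divisorTerm-cong {m} {n} {d} m⇒n n⇒m with d ∣? m | d ∣? n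
... | yes _   | yes _   = refl
... | yes d∣m | no d∤n  = contradiction (m⇒n d∣m) d∤n
... | no d∤m  | yes d∣n = contradiction (n⇒m d∣n) d∤m
... | no _    | no _    = refl

divisorTerm-*ˡ : ∀ q n d → divisorTerm (suc q * n) (suc q * d) ≡ suc q * divisorTerm n d
divisorTerm-*ˡ q n d with suc q * d ∣? suc q * n | d ∣? n
... | yes _   | yes _   = refl
... | yes qd∣ | no d∤n  = contradiction (*-cancelˡ-∣ (suc q) qd∣) d∤n
... | no qd∤  | yes d∣n = contradiction (*-monoʳ-∣ (suc q) d∣n) qd∤
... | no _    | no _    = sym (*-zeroʳ q)

sum-filter-singleton : ∀ {P : ℕ → Set} (P? : Decidable P) x → sum (filter P? [ x ]) ≡ (if does (P? x) then x else 0)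
sum-filter-singleton P? x with does (P? x)
... | true  = +-identityʳ x
... | false = refl

sum-filter-divisors : ∀ n m → sum (filter (_∣? n) (map suc (upTo m))) ≡ sumTo (divisorTerm n) m
sum-filter-divisors n zero    = refl
sum-filter-divisors n (suc m) = begin
  sum (filter (_∣? n) (map suc (upTo (suc m))))
    ≡⟨ cong (λ l → sum (filter (_∣? n) (map suc l))) (upTo-∷ʳ m) ⟨
  sum (filter (_∣? n) (map suc (upTo m ++ [ m ])))
    ≡⟨ cong (λ l → sum (filter (_∣? n) l)) (map-++ suc (upTo m) [ m ]) ⟩
  sum (filter (_∣? n) (map suc (upTo m) ++ [ suc m ]))
    ≡⟨ cong sum (filter-++ (_∣? n) (map suc (upTo m)) [ suc m ]) ⟩
  sum (filter (_∣? n) (map suc (upTo m)) ++ filter (_∣? n) [ suc m ])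
    ≡⟨ sum-++ (filter (_∣? n) (map suc (upTo m))) (filter (_∣? n) [ suc m ]) ⟩
  sum (filter (_∣? n) (map suc (upTo m))) + sum (filter (_∣? n) [ suc m ])
    ≡⟨ cong₂ _+_ (sum-filter-divisors n m) (sum-filter-singleton (_∣? n) (suc m)) ⟩
  sumTo (divisorTerm n) (suc m) ∎
  where open ≡-Reasoning

σ≡sumTo : ∀ n → σ n ≡ sumTo (divisorTerm n) n
σ≡sumTo n = sum-filter-divisors n n

sumTo-divisorTerm-≥ : ∀ {n m} → 0 < n → n ≤ m → sumTo (divisorTerm n) m ≡ σ n
sumTo-divisorTerm-≥ {n} {m} 0<n n≤m = begin
  sumTo (divisorTerm n) m                                      ≡⟨ cong (sumTo (divisorTerm n)) (m+[n∸m]≡n n≤m) ⟨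
  sumTo (divisorTerm n) (n + (m ∸ n))                          ≡⟨ sumTo-split (divisorTerm n) n (m ∸ n) ⟩
  sumTo (divisorTerm n) n + sumTo (λ i → divisorTerm n (n + i)) (m ∸ n)
    ≡⟨ cong₂ _+_ (sym (σ≡sumTo n)) (sumTo-zero (m ∸ n) (λ 1≤i _ → divisorTerm-∤ (n+i∤n 1≤i))) ⟩
  σ n + 0                                                      ≡⟨ +-identityʳ (σ n) ⟩
  σ n ∎
  where
  open ≡-Reasoning
  n+i∤n : ∀ {i} → 1 ≤ i → n + i ∤ n
  n+i∤n 1≤i n+i∣n = <⇒≱ (m<m+n n 1≤i) (∣⇒≤ {{>-nonZero 0<n}} n+i∣n)

σ∣ σ∤ : ℕ → ℕ → ℕ
σ∣ p n = sumTo (λ d → if does (p ∣? d) then divisorTerm n d else 0) n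
σ∤ p n = sumTo (λ d → if does (p ∣? d) then 0 else divisorTerm n d) n

σ≡σ∣+σ∤ : ∀ p n → σ n ≡ σ∣ p n + σ∤ p n
σ≡σ∣+σ∤ p n = begin
  σ n                                 ≡⟨ σ≡sumTo n ⟩
  sumTo (divisorTerm n) n             ≡⟨ sumTo-cong n (λ {d} _ _ → split (does (p ∣? d)) (divisorTerm n d)) ⟩
  sumTo (λ d → (if does (p ∣? d) then divisorTerm n d else 0) + (if does (p ∣? d) then 0 else divisorTerm n d)) n
                                      ≡⟨ sumTo-+ _ _ n ⟩
  σ∣ p n + σ∤ p n ∎
  where
  open ≡-Reasoning
  split : ∀ b x → x ≡ (if b then x else 0) + (if b then 0 else x)
  split true  x = sym (+-identityʳ x)
  split false x = refl

σ∣-*ˡ : ∀ q n → σ∣ (suc q) (suc q * n) ≡ suc q * σ n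
σ∣-*ˡ q n = begin
  σ∣ p (p * n)                                   ≡⟨ sumTo-multiples q off-multiples n ⟩
  sumTo (λ e → if does (p ∣? p * e) then divisorTerm (p * n) (p * e) else 0) n
    ≡⟨ sumTo-cong n (λ {e} _ _ → on-multiples e) ⟩
  sumTo (λ e → p * divisorTerm n e) n            ≡⟨ sumTo-*ˡ p (divisorTerm n) n ⟩
  p * sumTo (divisorTerm n) n                    ≡⟨ cong (p *_) (σ≡sumTo n) ⟨
  p * σ n ∎
  where
  open ≡-Reasoning
  p : ℕ
  p = suc q
  off-multiples : ∀ {d} → p ∤ d → (if does (p ∣? d) then divisorTerm (p * n) d else 0) ≡ 0
  off-multiples {d} = if-does-no (p ∣? d)
  on-multiples : ∀ e → (if does (p ∣? p * e) then divisorTerm (p * n) (p * e) else 0) ≡ p * divisorTerm n e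
  on-multiples e = trans (if-does-yes (p ∣? p * e) (m∣m*n e)) (divisorTerm-*ˡ q n e)

*-σ≤σ-* : ∀ k n → k * σ n ≤ σ (k * n)
*-σ≤σ-* zero    n = z≤n
*-σ≤σ-* (suc q) n = begin
  suc q * σ n                                       ≡⟨ σ∣-*ˡ q n ⟨
  σ∣ (suc q) (suc q * n)                            ≤⟨ m≤m+n _ _ ⟩
  σ∣ (suc q) (suc q * n) + σ∤ (suc q) (suc q * n)   ≡⟨ σ≡σ∣+σ∤ (suc q) (suc q * n) ⟨
  σ (suc q * n) ∎
  where open ≤-Reasoning

prime∤⇒coprime : ∀ {p i} → Prime p → p ∤ i → Coprime i p
prime∤⇒coprime pr p∤i (d∣i , d∣p) with prime⇒irreducible pr d∣p
... | inj₁ d≡1 = d≡1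
... | inj₂ refl = contradiction d∣i p∤i

∣p^b*m⇒∣m : ∀ {p i m} → Prime p → p ∤ i → ∀ b → i ∣ p ^ b * m → i ∣ m
∣p^b*m⇒∣m {p} {i} {m} pr p∤i zero    i∣ = subst (i ∣_) (*-identityˡ m) i∣
∣p^b*m⇒∣m {p} {i} {m} pr p∤i (suc b) i∣ =
  ∣p^b*m⇒∣m pr p∤i b (coprime-divisor (prime∤⇒coprime pr p∤i) (subst (i ∣_) (*-assoc p (p ^ b) m) i∣))

σ∤-^-* : ∀ {p m} → Prime p → p ∤ m → ∀ b → σ∤ p (p ^ suc b * m) ≡ σ m
σ∤-^-* {p} {m} pr p∤m b = begin
  σ∤ p n                    ≡⟨ sumTo-cong n (λ {d} _ _ → non-multiple-term d) ⟩
  sumTo (divisorTerm m) n   ≡⟨ sumTo-divisorTerm-≥ 0<m (m≤n*m m (p ^ suc b) {{p^suc-b≢0}}) ⟩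
  σ m ∎
  where
  open ≡-Reasoning
  n : ℕ
  n = p ^ suc b * m
  p^suc-b≢0 : NonZero (p ^ suc b)
  p^suc-b≢0 = m^n≢0 p (suc b) {{prime⇒nonZero pr}}
  0<m : 0 < m
  0<m = n≢0⇒n>0 (λ { refl → p∤m (p ∣0) })
  non-multiple-term : ∀ d → (if does (p ∣? d) then 0 else divisorTerm n d) ≡ divisorTerm m d
  non-multiple-term d with p ∣? d
  ... | yes p∣d = sym (divisorTerm-∤ (λ d∣m → p∤m (∣-trans p∣d d∣m)))
  ... | no p∤d  = divisorTerm-cong (∣p^b*m⇒∣m pr p∤d (suc b)) (∣n⇒∣m*n (p ^ suc b))

σ-^-suc-* : ∀ {p m} → Prime p → p ∤ m → ∀ b → σ (p ^ suc b * m) ≡ p * σ (p ^ b * m) + σ m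
σ-^-suc-* {zero}  pr = contradiction pr ¬prime[0]
σ-^-suc-* {suc q} {m} pr p∤m b = begin
  σ (p ^ suc b * m)                 ≡⟨ cong σ (*-assoc p (p ^ b) m) ⟩
  σ (p * k)                         ≡⟨ σ≡σ∣+σ∤ p (p * k) ⟩
  σ∣ p (p * k) + σ∤ p (p * k)       ≡⟨ cong (σ∣ p (p * k) +_) (cong (σ∤ p) (*-assoc p (p ^ b) m)) ⟨
  σ∣ p (p * k) + σ∤ p (p ^ suc b * m) ≡⟨ cong₂ _+_ (σ∣-*ˡ q k) (σ∤-^-* pr p∤m b) ⟩
  p * σ k + σ m ∎
  where
  open ≡-Reasoning
  p k : ℕ
  p = suc q
  k = p ^ b * m

σ-^-suc : ∀ {p} → Prime p → ∀ a → σ (p ^ suc a) ≡ p * σ (p ^ a) + 1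
σ-^-suc {p} pr a =
  subst₂ (λ x y → σ x ≡ p * σ y + 1) (*-identityʳ (p ^ suc a)) (*-identityʳ (p ^ a)) (σ-^-suc-* pr p∤1 a)
  where
  p∤1 : p ∤ 1
  p∤1 p∣1 = ¬prime[1] (subst Prime (∣1⇒≡1 p∣1) pr)

σ-^-* : ∀ {p m} → Prime p → p ∤ m → ∀ a → σ (p ^ a * m) ≡ σ (p ^ a) * σ m
σ-^-* {p} {m} pr p∤m zero    = trans (cong σ (*-identityˡ m)) (sym (*-identityˡ (σ m)))
σ-^-* {p} {m} pr p∤m (suc a) = begin
  σ (p ^ suc a * m)                   ≡⟨ σ-^-suc-* pr p∤m a ⟩
  p * σ (p ^ a * m) + σ m             ≡⟨ cong (λ x → p * x + σ m) (σ-^-* pr p∤m a) ⟩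
  p * (σ (p ^ a) * σ m) + σ m         ≡⟨ cong₂ _+_ (*-assoc p (σ (p ^ a)) (σ m)) (*-identityˡ (σ m)) ⟨
  p * σ (p ^ a) * σ m + 1 * σ m       ≡⟨ *-distribʳ-+ (σ m) (p * σ (p ^ a)) 1 ⟨
  (p * σ (p ^ a) + 1) * σ m           ≡⟨ cong (_* σ m) (σ-^-suc pr a) ⟨
  σ (p ^ suc a) * σ m ∎
  where open ≡-Reasoning

σ-^-∣σ : ∀ {p a n} → Prime p → ExactPow p a n → σ (p ^ a) ∣ σ n
σ-^-∣σ {p} {a} {n} pr (divides k n≡k*p^a , p^1+a∤n) = divides (σ k) (begin
  σ n             ≡⟨ cong σ (trans n≡k*p^a (*-comm k (p ^ a))) ⟩
  σ (p ^ a * k)   ≡⟨ σ-^-* pr p∤k a ⟩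
  σ (p ^ a) * σ k ≡⟨ *-comm (σ (p ^ a)) (σ k) ⟩
  σ k * σ (p ^ a) ∎)
  where
  open ≡-Reasoning
  p∤k : p ∤ k
  p∤k p∣k = p^1+a∤n (subst (p ^ suc a ∣_) (sym n≡k*p^a) (*-monoˡ-∣ (p ^ a) p∣k))

coprime⇒*∣ : ∀ {m n c} → Coprime m n → m ∣ c → n ∣ c → m * n ∣ c
coprime⇒*∣ {m} {n} cop m∣c n∣c = subst (_∣ _) lcm≡m*n (lcm-least m∣c n∣c)
  where
  lcm≡m*n : lcm m n ≡ m * n
  lcm≡m*n = trans (sym (*-identityˡ (lcm m n)))
                  (trans (cong (_* lcm m n) (sym (coprime⇒gcd≡1 cop))) (gcd*lcm m n))

perfect⇒σ≤2* : ∀ {n d} → σ n ≡ 2 * n → 0 < n → d ∣ n → σ d ≤ 2 * d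
perfect⇒σ≤2* {d = d} perfect 0<n (divides k@(suc _) refl) = *-cancelˡ-≤ k (begin
  k * σ d     ≤⟨ *-σ≤σ-* k d ⟩
  σ (k * d)   ≡⟨ perfect ⟩
  2 * (k * d) ≡⟨ *-left-comm 2 k d ⟩
  k * (2 * d) ∎)
  where open ≤-Reasoning

oddPerfect⇒4∤σ-^ : ∀ {n p a} → 2 ∤ n → σ n ≡ 2 * n → Prime p → ExactPow p a n → 4 ∤ σ (p ^ a)
oddPerfect⇒4∤σ-^ {a = a} 2∤n perfect pr p^a∥n 4∣σ =
  2∤n (*-cancelˡ-∣ 2 (subst (4 ∣_) perfect (∣-trans 4∣σ (σ-^-∣σ {a = a} pr p^a∥n))))

prime[3] : Prime 3
prime[3] = from-yes (prime? 3)

abundant∤perfect : ∀ {n d} → σ n ≡ 2 * n → 0 < n → 2 * d < σ d → d ∤ n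
abundant∤perfect perfect 0<n 2d<σd d∣n = <⇒≱ 2d<σd (perfect⇒σ≤2* perfect 0<n d∣n)

perfect⇒¬3^4∥ : ∀ {n} → σ n ≡ 2 * n → 0 < n → 5 ^ 2 ∣ n → 13 ∣ n → ¬ ExactPow 3 4 n
perfect⇒¬3^4∥ {n} perfect 0<n 25∣n 13∣n 3^4∥n@(81∣n , _) =
  abundant∤perfect {d = 3 ^ 4 * 3575} perfect 0<n abundant
    (coprime⇒*∣ (from-yes (coprime? 81 3575)) 81∣n
      (coprime⇒*∣ (from-yes (coprime? 25 143)) 25∣n (coprime⇒*∣ (from-yes (coprime? 13 11)) 13∣n 11∣n)))
  where
  11∣n : 11 ∣ n
  11∣n = coprime-divisor (from-yes (coprime? 11 2))
           (subst (11 ∣_) perfect (∣-trans (divides 11 refl) (σ-^-∣σ {a = 4} prime[3] 3^4∥n)))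
  abundant : 2 * (3 ^ 4 * 3575) < σ (3 ^ 4 * 3575)
  abundant = subst (2 * (3 ^ 4 * 3575) <_) (sym (σ-^-* prime[3] (from-no (3 ∣? 3575)) 4)) (<ᵇ⇒< _ _ _)

perfect⇒3^6∤ : ∀ {n} → σ n ≡ 2 * n → 0 < n → 5 ^ 2 ∣ n → 13 ∣ n → 3 ^ 6 ∤ n
perfect⇒3^6∤ perfect 0<n 25∣n 13∣n 729∣n =
  abundant∤perfect {d = 3 ^ 6 * 325} perfect 0<n abundant
    (coprime⇒*∣ (from-yes (coprime? 729 325)) 729∣n (coprime⇒*∣ (from-yes (coprime? 25 13)) 25∣n 13∣n))
  where
  abundant : 2 * (3 ^ 6 * 325) < σ (3 ^ 6 * 325)
  abundant = subst (2 * (3 ^ 6 * 325) <_) (sym (σ-^-* prime[3] (from-no (3 ∣? 325)) 6)) (<ᵇ⇒< _ _ _)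

lemma6 : (N : ℕ) → 0 < N → ¬ (2 ∣ N) → σ N ≡ 2 * N →
    3 ∣ N → 5 ∣ N → 13 ∣ N →
    ExactPow 5 1 N ⊎ ExactPow 3 2 N
lemma6 N 0<N 2∤N perfect 3∣N 5∣N 13∣N with 5 ^ 2 ∣? N
... | no 5^2∤N = inj₁ (5∣N , 5^2∤N)
... | yes 5^2∣N with 3 ^ 2 ∣? N
... | no 3^2∤N = ⊥-elim (oddPerfect⇒4∤σ-^ {a = 1} 2∤N perfect prime[3] (3∣N , 3^2∤N) (divides 1 refl))
... | yes 3^2∣N with 3 ^ 3 ∣? N
... | no 3^3∤N = inj₂ (3^2∣N , 3^3∤N)
... | yes 3^3∣N with 3 ^ 4 ∣? N
... | no 3^4∤N = ⊥-elim (oddPerfect⇒4∤σ-^ {a = 3} 2∤N perfect prime[3] (3^3∣N , 3^4∤N) (divides 10 refl))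
... | yes 3^4∣N with 3 ^ 5 ∣? N
... | no 3^5∤N = ⊥-elim (perfect⇒¬3^4∥ perfect 0<N 5^2∣N 13∣N (3^4∣N , 3^5∤N))
... | yes 3^5∣N with 3 ^ 6 ∣? N
... | no 3^6∤N = ⊥-elim (oddPerfect⇒4∤σ-^ {a = 5} 2∤N perfect prime[3] (3^5∣N , 3^6∤N) (divides 91 refl))
... | yes 3^6∣N = ⊥-elim (perfect⇒3^6∤ perfect 0<N 5^2∣N 13∣N 3^6∣N)
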